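{- In $\mathbb{Z}_{91}$ let $H_1=\{1,16,74\}$ and $H_2=\{1,9,81\}$ (subgroups of the unit group $\mathbb{Z}_{91}^*$), and for a subgroup $H$ and a subset $S$ write $HS=\{hs \bmod 91: h\in H, s\in S\}$. Define $X_1=H_1\{1,2,7,14,15,17,19,22,25,28,38,43,44,50,55\}$, $Y_1=H_1\{2,3,10,11,14,17,20,22,28,43,44,45,49,50,55\}$; $X_2=H_1\{1,4,5,8,9,11,15,22,27,28,34,38,43,49,50\}$, $Y_2=H_1\{8,9,10,11,14,17,22,25,28,33,34,38,44,50,55\}$; $X_3=H_1\{2,3,5,9,10,14,15,20,27,28,33,34,38,50,55\}$, $Y_3=H_1\{3,4,11,14,19,25,27,28,33,34,43,44,45,50,55\}$; $X_4=H_2\{2,5,14,16,19,20,23,24,29,30,37,40,46,48,49\}$, $Y_4=H_2\{2,4,6,8,13,14,16,23,30,37,38,39,40,46,49\}$. Then each $(X_i,Y_i)$, $i=1,2,3,4$, is a difference family in $\mathbb{Z}_{91}$ with parameters $(91;45,45;44)$ (so cyclic Legendre pairs of length $91$ exist), and these four difference families are pairwise nonequivalent.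
   Context: A pair $(X,Y)$ of subsets of $\mathbb{Z}_v$ with $|X|=k_1$, $|Y|=k_2$ is a difference family with parameters $(v;k_1,k_2;\lambda)$ if every nonzero $d\in\mathbb{Z}_v$ arises as $x-x'$ ($x,x'\in X$) or $y-y'$ ($y,y'\in Y$) in exactly $\lambda$ ways in total. A Legendre difference family is one with $v=2n-1$ where $n=k_1+k_2-\lambda$. Equivalence of Legendre difference families $(X,Y)$ in $G=\mathbb{Z}_v$ is the equivalence relation generated by the elementary transformations: (i) interchange $X$ and $Y$; (ii) replace $X$ by $G\setminus X$; (iii) replace $X$ by a translate $X-s$, $s\in G$; (iv) replace $X$ by $-X$; (v) replace $(X,Y)$ by $(\alpha^{ -1}(X),\alpha^{ -1}(Y))$ for an automorphism $\alpha$ of $G$. (Transformations (ii)–(iv) applied to $X$ may equally be applied to $Y$ after using (i).) -}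

module Defs where

open import Data.Bool using (Bool; true; false; _∧_; _∨_)
open import Data.Nat using (ℕ; zero; suc; _+_; _*_; _∸_; NonZero)
open import Data.Nat.DivMod using (_mod_)
open import Data.Fin using (Fin; toℕ; _≟_)
open import Data.Fin.Subset using (Subset; ∁; ∣_∣)
open import Data.Vec using (lookup; tabulate)
open import Data.List using (List; []; _∷_; length; filterᵇ; cartesianProduct; allFin)
open import Data.Bool.ListAction using (any)
open import Data.Product using (_×_; _,_; proj₁; proj₂)
open import Relation.Nullary.Decidable using (⌊_⌋)
open import Relation.Binary.PropositionalEquality using (_≡_; _≢_)
open import Relation.Binary.Construct.Closure.Equivalence using (EqClosure)
open import Function.Definitions using (Bijective)

module _ {v : ℕ} .{{_ : NonZero v}} where

  infixl 6 _+ᵥ_ _-ᵥ_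

  _+ᵥ_ : Fin v → Fin v → Fin v
  a +ᵥ b = (toℕ a + toℕ b) mod v

  -ᵥ_ : Fin v → Fin v
  -ᵥ a = (v ∸ toℕ a) mod v

  _-ᵥ_ : Fin v → Fin v → Fin v
  a -ᵥ b = a +ᵥ (-ᵥ b)

  diffCount : Subset v → Fin v → ℕ
  diffCount X d = length (filterᵇ
    (λ p → lookup X (proj₁ p) ∧ lookup X (proj₂ p) ∧ ⌊ (proj₁ p -ᵥ proj₂ p) ≟ d ⌋)
    (cartesianProduct (allFin v) (allFin v)))

  IsDiffFamily : ℕ → ℕ → ℕ → Subset v → Subset v → Set
  IsDiffFamily k₁ k₂ lam X Y =
    ∣ X ∣ ≡ k₁ × ∣ Y ∣ ≡ k₂ ×
    (∀ (d : Fin v) → toℕ d ≢ 0 → diffCount X d + diffCount Y d ≡ lam)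

  prodSet : List ℕ → List ℕ → Subset v
  prodSet H S = tabulate (λ z →
    any (λ h → any (λ s → ⌊ ((h * s) mod v) ≟ z ⌋) S) H)

  IsAutomorphism : (Fin v → Fin v) → Set
  IsAutomorphism α = (∀ a b → α (a +ᵥ b) ≡ α a +ᵥ α b) × Bijective _≡_ _≡_ α

  translate : Subset v → Fin v → Subset v
  translate X s = tabulate (λ z → lookup X (z +ᵥ s))

  negate : Subset v → Subset v
  negate X = tabulate (λ z → lookup X (-ᵥ z))

  preimage : (Fin v → Fin v) → Subset v → Subset v
  preimage α X = tabulate (λ z → lookup X (α z))

  data Elementary : Subset v × Subset v → Subset v × Subset v → Set where
    swap      : ∀ X Y → Elementary (X , Y) (Y , X)
    compl     : ∀ X Y → Elementary (X , Y) (∁ X , Y)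
    transl    : ∀ X Y s → Elementary (X , Y) (translate X s , Y)
    neg       : ∀ X Y → Elementary (X , Y) (negate X , Y)
    auto      : ∀ X Y α → IsAutomorphism α →
                Elementary (X , Y) (preimage α X , preimage α Y)

  Equivalent : Subset v × Subset v → Subset v × Subset v → Set
  Equivalent = EqClosure Elementary

H₁ H₂ : List ℕ
H₁ = 1 ∷ 16 ∷ 74 ∷ []
H₂ = 1 ∷ 9 ∷ 81 ∷ []

X₁ Y₁ X₂ Y₂ X₃ Y₃ X₄ Y₄ : Subset 91
X₁ = prodSet H₁ (1 ∷ 2 ∷ 7 ∷ 14 ∷ 15 ∷ 17 ∷ 19 ∷ 22 ∷ 25 ∷ 28 ∷ 38 ∷ 43 ∷ 44 ∷ 50 ∷ 55 ∷ [])
Y₁ = prodSet H₁ (2 ∷ 3 ∷ 10 ∷ 11 ∷ 14 ∷ 17 ∷ 20 ∷ 22 ∷ 28 ∷ 43 ∷ 44 ∷ 45 ∷ 49 ∷ 50 ∷ 55 ∷ [])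
X₂ = prodSet H₁ (1 ∷ 4 ∷ 5 ∷ 8 ∷ 9 ∷ 11 ∷ 15 ∷ 22 ∷ 27 ∷ 28 ∷ 34 ∷ 38 ∷ 43 ∷ 49 ∷ 50 ∷ [])
Y₂ = prodSet H₁ (8 ∷ 9 ∷ 10 ∷ 11 ∷ 14 ∷ 17 ∷ 22 ∷ 25 ∷ 28 ∷ 33 ∷ 34 ∷ 38 ∷ 44 ∷ 50 ∷ 55 ∷ [])
X₃ = prodSet H₁ (2 ∷ 3 ∷ 5 ∷ 9 ∷ 10 ∷ 14 ∷ 15 ∷ 20 ∷ 27 ∷ 28 ∷ 33 ∷ 34 ∷ 38 ∷ 50 ∷ 55 ∷ [])
Y₃ = prodSet H₁ (3 ∷ 4 ∷ 11 ∷ 14 ∷ 19 ∷ 25 ∷ 27 ∷ 28 ∷ 33 ∷ 34 ∷ 43 ∷ 44 ∷ 45 ∷ 50 ∷ 55 ∷ [])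
X₄ = prodSet H₂ (2 ∷ 5 ∷ 14 ∷ 16 ∷ 19 ∷ 20 ∷ 23 ∷ 24 ∷ 29 ∷ 30 ∷ 37 ∷ 40 ∷ 46 ∷ 48 ∷ 49 ∷ [])
Y₄ = prodSet H₂ (2 ∷ 4 ∷ 6 ∷ 8 ∷ 13 ∷ 14 ∷ 16 ∷ 23 ∷ 30 ∷ 37 ∷ 38 ∷ 39 ∷ 40 ∷ 46 ∷ 49 ∷ [])

family : Fin 4 → Subset 91 × Subset 91
family Fin.zero = X₁ , Y₁
family (Fin.suc Fin.zero) = X₂ , Y₂
family (Fin.suc (Fin.suc Fin.zero)) = X₃ , Y₃
family (Fin.suc (Fin.suc (Fin.suc Fin.zero))) = X₄ , Y₄

module Submission where

-- Write a(X, d) = #{p ∈ X : p - d ∈ X} for the periodic autocorrelation of X.  The number of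
-- ways to write d as a difference of elements of X is a(X, d), so both parts of the theorem
-- reduce to evaluating O(v²) sums rather than O(v³) pair counts.  For nonequivalence, consider
-- the defect |X| - a(X, d).  Translating, negating or applying an automorphism permutes the
-- shifts d and so permutes the defects, and complementation leaves every defect unchanged
-- because a(∁X, d) + |X| = |∁X| + a(X, d) by inclusion-exclusion.  Hence the number of pairs
-- (Z, d) with Z ∈ {X, Y} and defect c is an invariant of (X, Y) for every c; for c = 23 it
-- takes the distinct values 36, 84, 60, 48 on the four families.

open import Defs
open import Algebra.Bundles using (AbelianGroup)
open import Algebra.Structures using (IsAbelianGroup)
open import Algebra.Consequences.Propositional using (comm∧idˡ⇒id; comm∧invˡ⇒inv)
open import Data.Bool using (Bool; true; false; _∧_; not)
open import Data.Bool.Properties using (∧-identityʳ; ∧-zeroʳ)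
open import Data.Fin using (Fin; toℕ; _≟_; punchIn)
open import Data.Fin.Permutation as Perm using (Permutation′; permutation; _⟨$⟩ʳ_)
open import Data.Fin.Properties using (toℕ-fromℕ<; toℕ-injective; toℕ<n; punchInᵢ≢i; all?)
open import Data.Fin.Subset using (Subset; ∁; ∣_∣)
open import Data.List using (List; []; _∷_; length; filterᵇ; cartesianProduct; allFin; map; _++_)
import Data.List as List
open import Data.List.Properties using (filter-++; length-++)
import Data.Nat as ℕ
open import Data.Nat using (ℕ; zero; suc; _+_; _∸_; _%_; _≡ᵇ_; NonZero)
open import Data.Nat.DivMod using (_mod_; %-distribˡ-+; m%n%n≡m%n; m<n⇒m%n≡m; n%n≡0)
open import Data.Nat.Properties
  using (+-comm; +-assoc; +-identityʳ; m∸n+n≡m; <⇒≤; +-0-commutativeMonoid; [m+n]∸[m+o]≡n∸o)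
open import Data.Product using (_×_; _,_; proj₁; proj₂)
open import Data.Vec.Functional using (removeAt)
open import Data.Vec using (Vec; lookup) renaming (_∷_ to _∷ᵛ_; [] to []ᵛ)
open import Data.Vec.Properties using (lookup∘tabulate; lookup-map)
open import Algebra.Properties.CommutativeMonoid.Sum +-0-commutativeMonoid
  using (sum; sum-cong-≗; sum-permute; sum-remove; ∑-distrib-+)
open import Function using (_∘_; _⇔_; mk⇔; mk⤖)
open import Function.Properties.Bijection using (⤖⇒↔)
open import Level using (0ℓ)
open import Relation.Binary.PropositionalEquality
open import Relation.Binary.PropositionalEquality.Algebra using (isMagma)
open import Relation.Binary.Construct.Closure.Equivalence using (gfold)
open import Relation.Nullary using (¬_)
open import Relation.Nullary.Decidable as Dec
  using (Dec; ⌊_⌋; T?; ¬?; _×-dec_; _→-dec_; toWitness; does-⇔; isYes≗does; dec-true; dec-false)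
open ≡-Reasoning

module _ {v : ℕ} .{{_ : NonZero v}} where

  0ᵥ : Fin v
  0ᵥ = v mod v

  private
    toℕ-+ᵥ : ∀ a b → toℕ (a +ᵥ b) ≡ (toℕ a + toℕ b) % v
    toℕ-+ᵥ a b = toℕ-fromℕ< _

    toℕ--ᵥ : ∀ a → toℕ (-ᵥ a) ≡ (v ∸ toℕ a) % v
    toℕ--ᵥ a = toℕ-fromℕ< _

    toℕ-0ᵥ : toℕ 0ᵥ ≡ 0
    toℕ-0ᵥ = trans (toℕ-fromℕ< _) (n%n≡0 v)

    %-absorbˡ : ∀ m n → (m % v + n) % v ≡ (m + n) % v
    %-absorbˡ m n = begin
      (m % v + n) % v         ≡⟨ %-distribˡ-+ (m % v) n v ⟩
      (m % v % v + n % v) % v ≡⟨ cong (λ x → (x + n % v) % v) (m%n%n≡m%n m v) ⟩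
      (m % v + n % v) % v     ≡⟨ %-distribˡ-+ m n v ⟨
      (m + n) % v             ∎

    toℕ-+ᵥ-+ᵥ : ∀ a b c → toℕ (a +ᵥ b +ᵥ c) ≡ (toℕ a + toℕ b + toℕ c) % v
    toℕ-+ᵥ-+ᵥ a b c = trans (toℕ-+ᵥ (a +ᵥ b) c)
      (trans (cong (λ x → (x + toℕ c) % v) (toℕ-+ᵥ a b)) (%-absorbˡ _ _))

  +ᵥ-comm : ∀ a b → a +ᵥ b ≡ b +ᵥ a
  +ᵥ-comm a b = toℕ-injective (begin
    toℕ (a +ᵥ b)        ≡⟨ toℕ-+ᵥ a b ⟩
    (toℕ a + toℕ b) % v ≡⟨ cong (_% v) (+-comm (toℕ a) (toℕ b)) ⟩
    (toℕ b + toℕ a) % v ≡⟨ toℕ-+ᵥ b a ⟨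
    toℕ (b +ᵥ a)        ∎)

  +ᵥ-assoc : ∀ a b c → a +ᵥ b +ᵥ c ≡ a +ᵥ (b +ᵥ c)
  +ᵥ-assoc a b c = toℕ-injective (begin
    toℕ (a +ᵥ b +ᵥ c)             ≡⟨ toℕ-+ᵥ-+ᵥ a b c ⟩
    (toℕ a + toℕ b + toℕ c) % v   ≡⟨ cong (_% v) (+-assoc (toℕ a) (toℕ b) (toℕ c)) ⟩
    (toℕ a + (toℕ b + toℕ c)) % v ≡⟨ cong (_% v) (+-comm (toℕ a) _) ⟩
    (toℕ b + toℕ c + toℕ a) % v   ≡⟨ toℕ-+ᵥ-+ᵥ b c a ⟨
    toℕ (b +ᵥ c +ᵥ a)             ≡⟨ cong toℕ (+ᵥ-comm (b +ᵥ c) a) ⟩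
    toℕ (a +ᵥ (b +ᵥ c))           ∎)

  +ᵥ-identityˡ : ∀ a → 0ᵥ +ᵥ a ≡ a
  +ᵥ-identityˡ a = toℕ-injective (begin
    toℕ (0ᵥ +ᵥ a)            ≡⟨ toℕ-+ᵥ 0ᵥ a ⟩
    (toℕ 0ᵥ + toℕ a) % v     ≡⟨ cong (λ x → (x + toℕ a) % v) toℕ-0ᵥ ⟩
    toℕ a % v                ≡⟨ m<n⇒m%n≡m (toℕ<n a) ⟩
    toℕ a                    ∎)

  -ᵥ-inverseˡ : ∀ a → -ᵥ a +ᵥ a ≡ 0ᵥ
  -ᵥ-inverseˡ a = toℕ-injective (begin
    toℕ (-ᵥ a +ᵥ a)                ≡⟨ toℕ-+ᵥ (-ᵥ a) a ⟩
    (toℕ (-ᵥ a) + toℕ a) % v       ≡⟨ cong (λ x → (x + toℕ a) % v) (toℕ--ᵥ a) ⟩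
    ((v ∸ toℕ a) % v + toℕ a) % v  ≡⟨ %-absorbˡ (v ∸ toℕ a) (toℕ a) ⟩
    (v ∸ toℕ a + toℕ a) % v        ≡⟨ cong (_% v) (m∸n+n≡m (<⇒≤ (toℕ<n a))) ⟩
    v % v                          ≡⟨ n%n≡0 v ⟩
    0                              ≡⟨ toℕ-0ᵥ ⟨
    toℕ 0ᵥ                         ∎)

  ℤᵥ-isAbelianGroup : IsAbelianGroup _≡_ _+ᵥ_ 0ᵥ (λ a → -ᵥ a)
  ℤᵥ-isAbelianGroup = record
    { isGroup = record
      { isMonoid = record
        { isSemigroup = record { isMagma = isMagma _+ᵥ_ ; assoc = +ᵥ-assoc }
        ; identity    = comm∧idˡ⇒id +ᵥ-comm +ᵥ-identityˡ
        }
      ; inverse = comm∧invˡ⇒inv +ᵥ-comm -ᵥ-inverseˡ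
      ; ⁻¹-cong = cong (λ a → -ᵥ a)
      }
    ; comm = +ᵥ-comm
    }

  ℤᵥ-abelianGroup : AbelianGroup 0ℓ 0ℓ
  ℤᵥ-abelianGroup = record { isAbelianGroup = ℤᵥ-isAbelianGroup }

  open import Algebra.Properties.AbelianGroup ℤᵥ-abelianGroup
    using (//-rightDividesˡ; //-rightDividesʳ; x≈z//y; ⁻¹-∙-comm)
  open import Algebra.Properties.CommutativeSemigroup
    (AbelianGroup.commutativeSemigroup ℤᵥ-abelianGroup) using (xy∙z≈xz∙y)

  -ᵥ-+ᵥ-cancel : ∀ x y → x -ᵥ y +ᵥ y ≡ x
  -ᵥ-+ᵥ-cancel x y = //-rightDividesˡ y x

  +ᵥ--ᵥ-cancel : ∀ x y → x +ᵥ y -ᵥ y ≡ x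
  +ᵥ--ᵥ-cancel x y = //-rightDividesʳ y x

  -ᵥ≡⇒≡-ᵥ : ∀ {x y z} → x -ᵥ y ≡ z → y ≡ x -ᵥ z
  -ᵥ≡⇒≡-ᵥ {x} {y} {z} x-y≡z = x≈z//y y z x (begin
    y +ᵥ z         ≡⟨ +ᵥ-comm y z ⟩
    z +ᵥ y         ≡⟨ cong (_+ᵥ y) x-y≡z ⟨
    x -ᵥ y +ᵥ y    ≡⟨ -ᵥ-+ᵥ-cancel x y ⟩
    x              ∎)

  -ᵥ≡⇔≡-ᵥ : ∀ {x y z} → (x -ᵥ y ≡ z) ⇔ (y ≡ x -ᵥ z)
  -ᵥ≡⇔≡-ᵥ = mk⇔ -ᵥ≡⇒≡-ᵥ (λ y≡x-z → sym (-ᵥ≡⇒≡-ᵥ (sym y≡x-z)))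

  -ᵥ-+ᵥ-comm : ∀ x y z → x -ᵥ y +ᵥ z ≡ x +ᵥ z -ᵥ y
  -ᵥ-+ᵥ-comm x y z = xy∙z≈xz∙y x (-ᵥ y) z

  -ᵥ-distrib--ᵥ : ∀ x y → -ᵥ (x -ᵥ y) ≡ (-ᵥ x) -ᵥ (-ᵥ y)
  -ᵥ-distrib--ᵥ x y = sym (⁻¹-∙-comm x (-ᵥ y))

  homomorphism-preserves--ᵥ : ∀ (α : Fin v → Fin v) → (∀ a b → α (a +ᵥ b) ≡ α a +ᵥ α b) →
                              ∀ x y → α (x -ᵥ y) ≡ α x -ᵥ α y
  homomorphism-preserves--ᵥ α α-hom x y =
    x≈z//y (α (x -ᵥ y)) (α y) (α x) (trans (sym (α-hom (x -ᵥ y) y)) (cong α (-ᵥ-+ᵥ-cancel x y)))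

𝟙[_] : Bool → ℕ
𝟙[ true ]  = 1
𝟙[ false ] = 0

length-filterᵇ-++ : ∀ {A : Set} (h : A → Bool) xs ys →
           length (filterᵇ h (xs ++ ys)) ≡ length (filterᵇ h xs) + length (filterᵇ h ys)
length-filterᵇ-++ h xs ys = trans (cong length (filter-++ (T? ∘ h) xs ys)) (length-++ (filterᵇ h xs))

length-filterᵇ-map : ∀ {A B : Set} (h : B → Bool) (g : A → B) xs →
            length (filterᵇ h (map g xs)) ≡ length (filterᵇ (h ∘ g) xs)
length-filterᵇ-map h g [] = refl
length-filterᵇ-map h g (x ∷ xs) with h (g x)
... | true  = cong suc (length-filterᵇ-map h g xs)
... | false = length-filterᵇ-map h g xs

length-filterᵇ-tabulate : ∀ {A : Set} {n} (h : A → Bool) (g : Fin n → A) →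
                 length (filterᵇ h (List.tabulate g)) ≡ sum (λ i → 𝟙[ h (g i) ])
length-filterᵇ-tabulate {n = zero}  h g = refl
length-filterᵇ-tabulate {n = suc n} h g with h (g Fin.zero)
... | true  = cong suc (length-filterᵇ-tabulate h (g ∘ Fin.suc))
... | false = length-filterᵇ-tabulate h (g ∘ Fin.suc)

length-filterᵇ-cartesianProduct : ∀ {A B : Set} {n} (h : A × B → Bool) (g : Fin n → A) (ys : List B) →
  length (filterᵇ h (cartesianProduct (List.tabulate g) ys)) ≡
  sum (λ i → length (filterᵇ (λ y → h (g i , y)) ys))
length-filterᵇ-cartesianProduct {n = zero}  h g ys = refl
length-filterᵇ-cartesianProduct {n = suc n} h g ys = begin
  length (filterᵇ h (map (g Fin.zero ,_) ys ++ cartesianProduct (List.tabulate (g ∘ Fin.suc)) ys))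
    ≡⟨ length-filterᵇ-++ h (map (g Fin.zero ,_) ys) _ ⟩
  length (filterᵇ h (map (g Fin.zero ,_) ys)) + length (filterᵇ h (cartesianProduct (List.tabulate (g ∘ Fin.suc)) ys))
    ≡⟨ cong₂ _+_ (length-filterᵇ-map h (g Fin.zero ,_) ys)
                 (length-filterᵇ-cartesianProduct h (g ∘ Fin.suc) ys) ⟩
  sum (λ i → length (filterᵇ (λ y → h (g i , y)) ys)) ∎

sum-𝟙-zero : ∀ n → sum {n} (λ _ → 𝟙[ false ]) ≡ 0
sum-𝟙-zero zero    = refl
sum-𝟙-zero (suc n) = sum-𝟙-zero n

sum-𝟙-∧-≟ : ∀ {n} (b : Fin n → Bool) (j : Fin n) → sum (λ i → 𝟙[ b i ∧ ⌊ i ≟ j ⌋ ]) ≡ 𝟙[ b j ]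
sum-𝟙-∧-≟ {suc n} b j = begin
  sum t                    ≡⟨ sum-remove {i = j} t ⟩
  t j + sum (removeAt t j) ≡⟨ cong₂ _+_ (cong 𝟙[_] (trans (cong (b j ∧_) ⌊j≟j⌋) (∧-identityʳ (b j))))
                                        rest≡0 ⟩
  𝟙[ b j ] + 0             ≡⟨ +-identityʳ _ ⟩
  𝟙[ b j ]                 ∎
  where
  t : Fin (suc n) → ℕ
  t i = 𝟙[ b i ∧ ⌊ i ≟ j ⌋ ]

  ⌊j≟j⌋ : ⌊ j ≟ j ⌋ ≡ true
  ⌊j≟j⌋ = trans (isYes≗does (j ≟ j)) (dec-true (j ≟ j) refl)

  ⌊punchIn≟j⌋ : ∀ k → ⌊ punchIn j k ≟ j ⌋ ≡ false
  ⌊punchIn≟j⌋ k = trans (isYes≗does (punchIn j k ≟ j)) (dec-false (punchIn j k ≟ j) (punchInᵢ≢i j k))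

  rest≡0 : sum (removeAt t j) ≡ 0
  rest≡0 = trans
    (sum-cong-≗ (λ k → cong 𝟙[_] (trans (cong (b (punchIn j k) ∧_) (⌊punchIn≟j⌋ k)) (∧-zeroʳ _))))
    (sum-𝟙-zero n)

∣∣≡sum-𝟙 : ∀ {n} (X : Subset n) → ∣ X ∣ ≡ sum (λ i → 𝟙[ lookup X i ])
∣∣≡sum-𝟙 []ᵛ            = refl
∣∣≡sum-𝟙 (true ∷ᵛ X)  = cong suc (∣∣≡sum-𝟙 X)
∣∣≡sum-𝟙 (false ∷ᵛ X) = ∣∣≡sum-𝟙 X

+≡+⇒∸≡∸ : ∀ {m n o p} → m + n ≡ o + p → o ∸ m ≡ n ∸ p
+≡+⇒∸≡∸ {m} {n} {o} {p} m+n≡o+p = begin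
  o ∸ m             ≡⟨ [m+n]∸[m+o]≡n∸o p o m ⟨
  (p + o) ∸ (p + m) ≡⟨ cong₂ _∸_ (trans (+-comm p o) (sym m+n≡o+p)) (+-comm p m) ⟩
  (m + n) ∸ (m + p) ≡⟨ [m+n]∸[m+o]≡n∸o m n p ⟩
  n ∸ p             ∎

module _ {v : ℕ} .{{_ : NonZero v}} where

  autocorrelation : Subset v → Fin v → ℕ
  autocorrelation X d = sum (λ p → 𝟙[ lookup X p ∧ lookup X (p -ᵥ d) ])

  diffCount≡autocorrelation : ∀ X d → diffCount X d ≡ autocorrelation X d
  diffCount≡autocorrelation X d = begin
    diffCount X d
      ≡⟨ length-filterᵇ-cartesianProduct {n = v} _ (λ p → p) (allFin v) ⟩
    sum (λ p → length (filterᵇ (λ q → lookup X p ∧ lookup X q ∧ ⌊ p -ᵥ q ≟ d ⌋) (allFin v)))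
      ≡⟨ sum-cong-≗ {v} (λ p → length-filterᵇ-tabulate {n = v} _ (λ q → q)) ⟩
    sum (λ p → sum (λ q → 𝟙[ lookup X p ∧ lookup X q ∧ ⌊ p -ᵥ q ≟ d ⌋ ]))
      ≡⟨ sum-cong-≗ partners ⟩
    autocorrelation X d ∎
    where
    partners : ∀ p → sum (λ q → 𝟙[ lookup X p ∧ lookup X q ∧ ⌊ p -ᵥ q ≟ d ⌋ ])
                   ≡ 𝟙[ lookup X p ∧ lookup X (p -ᵥ d) ]
    partners p with lookup X p
    ... | false = sum-𝟙-zero v
    ... | true  = trans (sum-cong-≗ (λ q → cong (λ t → 𝟙[ lookup X q ∧ t ]) (⌊p-q≟d⌋≡⌊q≟p-d⌋ q)))
                        (sum-𝟙-∧-≟ (lookup X) (p -ᵥ d))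
      where
      ⌊p-q≟d⌋≡⌊q≟p-d⌋ : ∀ q → ⌊ p -ᵥ q ≟ d ⌋ ≡ ⌊ q ≟ p -ᵥ d ⌋
      ⌊p-q≟d⌋≡⌊q≟p-d⌋ q =
        trans (isYes≗does _) (trans (does-⇔ -ᵥ≡⇔≡-ᵥ (p -ᵥ q ≟ d) (q ≟ p -ᵥ d)) (sym (isYes≗does _)))

  translation : Fin v → Permutation′ v
  translation s = permutation (_+ᵥ s) (_-ᵥ s) (λ x → -ᵥ-+ᵥ-cancel x s) (λ x → +ᵥ--ᵥ-cancel x s)

  negation : Permutation′ v
  negation = permutation (λ x → -ᵥ x) (λ x → -ᵥ x) ⁻¹-involutive ⁻¹-involutive
    where open import Algebra.Properties.AbelianGroup ℤᵥ-abelianGroup using (⁻¹-involutive)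

  automorphism : ∀ {α} → IsAutomorphism α → Permutation′ v
  automorphism {α} (_ , α-bijective) = ⤖⇒↔ (mk⤖ {to = α} α-bijective)

  ∣preimage∣ : ∀ (σ : Permutation′ v) X → ∣ preimage (σ ⟨$⟩ʳ_) X ∣ ≡ ∣ X ∣
  ∣preimage∣ σ X = begin
    ∣ preimage (σ ⟨$⟩ʳ_) X ∣
      ≡⟨ ∣∣≡sum-𝟙 (preimage (σ ⟨$⟩ʳ_) X) ⟩
    sum (λ p → 𝟙[ lookup (preimage (σ ⟨$⟩ʳ_) X) p ])
      ≡⟨ sum-cong-≗ {v} (λ p → cong 𝟙[_] (lookup∘tabulate _ p)) ⟩
    sum (λ p → 𝟙[ lookup X (σ ⟨$⟩ʳ p) ])
      ≡⟨ sum-permute _ σ ⟨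
    sum (λ p → 𝟙[ lookup X p ])
      ≡⟨ ∣∣≡sum-𝟙 X ⟨
    ∣ X ∣ ∎

  autocorrelation-preimage : ∀ (σ τ : Permutation′ v) →
    (∀ p d → σ ⟨$⟩ʳ (p -ᵥ d) ≡ (σ ⟨$⟩ʳ p) -ᵥ (τ ⟨$⟩ʳ d)) →
    ∀ X d → autocorrelation (preimage (σ ⟨$⟩ʳ_) X) d ≡ autocorrelation X (τ ⟨$⟩ʳ d)
  autocorrelation-preimage σ τ σ-compat X d = begin
    sum (λ p → 𝟙[ lookup (preimage (σ ⟨$⟩ʳ_) X) p ∧ lookup (preimage (σ ⟨$⟩ʳ_) X) (p -ᵥ d) ])
      ≡⟨ sum-cong-≗ {v} (λ p → cong₂ (λ a b → 𝟙[ a ∧ b ]) (lookup∘tabulate _ p)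
           (trans (lookup∘tabulate _ (p -ᵥ d)) (cong (lookup X) (σ-compat p d)))) ⟩
    sum (λ p → 𝟙[ lookup X (σ ⟨$⟩ʳ p) ∧ lookup X ((σ ⟨$⟩ʳ p) -ᵥ (τ ⟨$⟩ʳ d)) ])
      ≡⟨ sum-permute _ σ ⟨
    autocorrelation X (τ ⟨$⟩ʳ d) ∎

  sum-𝟙-shift : ∀ X d → sum (λ p → 𝟙[ lookup X (p -ᵥ d) ]) ≡ ∣ X ∣
  sum-𝟙-shift X d = begin
    sum (λ p → 𝟙[ lookup X (p -ᵥ d) ])
      ≡⟨ sum-cong-≗ {v} (λ p → cong 𝟙[_] (lookup∘tabulate _ p)) ⟨
    sum (λ p → 𝟙[ lookup (translate X (-ᵥ d)) p ])
      ≡⟨ ∣∣≡sum-𝟙 (translate X (-ᵥ d)) ⟨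
    ∣ translate X (-ᵥ d) ∣
      ≡⟨ ∣preimage∣ (translation (-ᵥ d)) X ⟩
    ∣ X ∣ ∎

  autocorrelation-∁ : ∀ X d → autocorrelation (∁ X) d + ∣ X ∣ ≡ ∣ ∁ X ∣ + autocorrelation X d
  autocorrelation-∁ X d = begin
    autocorrelation (∁ X) d + ∣ X ∣
      ≡⟨ cong (autocorrelation (∁ X) d +_) (sum-𝟙-shift X d) ⟨
    autocorrelation (∁ X) d + sum (λ p → 𝟙[ lookup X (p -ᵥ d) ])
      ≡⟨ ∑-distrib-+ {v} _ _ ⟨
    sum (λ p → 𝟙[ lookup (∁ X) p ∧ lookup (∁ X) (p -ᵥ d) ] + 𝟙[ lookup X (p -ᵥ d) ])
      ≡⟨ sum-cong-≗ {v} pointwise ⟩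
    sum (λ p → 𝟙[ lookup (∁ X) p ] + 𝟙[ lookup X p ∧ lookup X (p -ᵥ d) ])
      ≡⟨ ∑-distrib-+ {v} _ _ ⟩
    sum (λ p → 𝟙[ lookup (∁ X) p ]) + autocorrelation X d
      ≡⟨ cong (_+ autocorrelation X d) (∣∣≡sum-𝟙 (∁ X)) ⟨
    ∣ ∁ X ∣ + autocorrelation X d ∎
    where
    𝟙-split : ∀ a b → 𝟙[ not a ∧ not b ] + 𝟙[ b ] ≡ 𝟙[ not a ] + 𝟙[ a ∧ b ]
    𝟙-split true  true  = refl
    𝟙-split true  false = refl
    𝟙-split false true  = refl
    𝟙-split false false = refl

    pointwise : ∀ p → 𝟙[ lookup (∁ X) p ∧ lookup (∁ X) (p -ᵥ d) ] + 𝟙[ lookup X (p -ᵥ d) ]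
                    ≡ 𝟙[ lookup (∁ X) p ] + 𝟙[ lookup X p ∧ lookup X (p -ᵥ d) ]
    pointwise p
      rewrite lookup-map p not X | lookup-map (p -ᵥ d) not X = 𝟙-split (lookup X p) (lookup X (p -ᵥ d))

  defect : Subset v → Fin v → ℕ
  defect X d = ∣ X ∣ ∸ autocorrelation X d

  defect-preimage : ∀ (σ τ : Permutation′ v) →
    (∀ p d → σ ⟨$⟩ʳ (p -ᵥ d) ≡ (σ ⟨$⟩ʳ p) -ᵥ (τ ⟨$⟩ʳ d)) →
    ∀ X d → defect (preimage (σ ⟨$⟩ʳ_) X) d ≡ defect X (τ ⟨$⟩ʳ d)
  defect-preimage σ τ σ-compat X d =
    cong₂ _∸_ (∣preimage∣ σ X) (autocorrelation-preimage σ τ σ-compat X d)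

  defect-∁ : ∀ X d → defect (∁ X) d ≡ defect X d
  defect-∁ X d = +≡+⇒∸≡∸ {autocorrelation (∁ X) d} {∣ X ∣} {∣ ∁ X ∣} (autocorrelation-∁ X d)

  defectCount : ℕ → Subset v → ℕ
  defectCount c X = sum (λ d → 𝟙[ defect X d ≡ᵇ c ])

  defectCount-reindex : ∀ c (τ : Permutation′ v) X Y →
    (∀ d → defect Y d ≡ defect X (τ ⟨$⟩ʳ d)) → defectCount c Y ≡ defectCount c X
  defectCount-reindex c τ X Y Y≗X∘τ =
    trans (sum-cong-≗ {v} (λ d → cong (λ k → 𝟙[ k ≡ᵇ c ]) (Y≗X∘τ d))) (sym (sum-permute _ τ))

  pairDefectCount : ℕ → Subset v × Subset v → ℕ
  pairDefectCount c (X , Y) = defectCount c X + defectCount c Y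

  pairDefectCount-elementary : ∀ c {P Q} → Elementary P Q → pairDefectCount c P ≡ pairDefectCount c Q
  pairDefectCount-elementary c (swap X Y) = +-comm (defectCount c X) (defectCount c Y)
  pairDefectCount-elementary c (compl X Y) =
    cong (_+ defectCount c Y) (sym (defectCount-reindex c Perm.id X (∁ X) (defect-∁ X)))
  pairDefectCount-elementary c (transl X Y s) =
    cong (_+ defectCount c Y) (sym (defectCount-reindex c Perm.id X (translate X s)
      (defect-preimage (translation s) Perm.id (λ p d → -ᵥ-+ᵥ-comm p d s) X)))
  pairDefectCount-elementary c (neg X Y) =
    cong (_+ defectCount c Y) (sym (defectCount-reindex c negation X (negate X)
      (defect-preimage negation negation -ᵥ-distrib--ᵥ X)))
  pairDefectCount-elementary c (auto X Y α α-auto) = sym (cong₂ _+_ (invariant X) (invariant Y))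
    where
    invariant : ∀ Z → defectCount c (preimage α Z) ≡ defectCount c Z
    invariant Z = defectCount-reindex c (automorphism α-auto) Z (preimage α Z)
      (defect-preimage (automorphism α-auto) (automorphism α-auto)
        (homomorphism-preserves--ᵥ α (proj₁ α-auto)) Z)

  pairDefectCount-equivalent : ∀ c {P Q} → Equivalent P Q → pairDefectCount c P ≡ pairDefectCount c Q
  pairDefectCount-equivalent c = gfold isEquivalence (pairDefectCount c) (pairDefectCount-elementary c)

  isDiffFamily? : ∀ k₁ k₂ lam X Y → Dec (IsDiffFamily k₁ k₂ lam X Y)
  isDiffFamily? k₁ k₂ lam X Y =
    ∣ X ∣ ℕ.≟ k₁ ×-dec ∣ Y ∣ ℕ.≟ k₂ ×-dec
    Dec.map autocorrelation⇔diffCount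
      (all? (λ d → ¬? (toℕ d ℕ.≟ 0) →-dec (autocorrelation X d + autocorrelation Y d ℕ.≟ lam)))
    where
    diffCounts≡autocorrelations : ∀ d → diffCount X d + diffCount Y d ≡ autocorrelation X d + autocorrelation Y d
    diffCounts≡autocorrelations d = cong₂ _+_ (diffCount≡autocorrelation X d) (diffCount≡autocorrelation Y d)

    autocorrelation⇔diffCount :
      (∀ d → toℕ d ≢ 0 → autocorrelation X d + autocorrelation Y d ≡ lam) ⇔
      (∀ d → toℕ d ≢ 0 → diffCount X d + diffCount Y d ≡ lam)
    autocorrelation⇔diffCount = mk⇔
      (λ h d d≢0 → trans (diffCounts≡autocorrelations d) (h d d≢0))
      (λ h d d≢0 → trans (sym (diffCounts≡autocorrelations d)) (h d d≢0))

familiesAreDiffFamilies : ∀ i → IsDiffFamily 45 45 44 (proj₁ (family i)) (proj₂ (family i))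
familiesAreDiffFamilies =
  toWitness {a? = all? (λ i → isDiffFamily? 45 45 44 (proj₁ (family i)) (proj₂ (family i)))} _

defectCounts₂₃ : Vec ℕ 4
defectCounts₂₃ = 36 ∷ᵛ 84 ∷ᵛ 60 ∷ᵛ 48 ∷ᵛ []ᵛ

family-pairDefectCount₂₃ : ∀ i → pairDefectCount 23 (family i) ≡ lookup defectCounts₂₃ i
family-pairDefectCount₂₃ =
  toWitness {a? = all? (λ i → pairDefectCount 23 (family i) ℕ.≟ lookup defectCounts₂₃ i)} _

defectCounts₂₃-distinct : ∀ i j → lookup defectCounts₂₃ i ≡ lookup defectCounts₂₃ j → i ≡ j
defectCounts₂₃-distinct =
  toWitness {a? = all? (λ i → all? (λ j →
    (lookup defectCounts₂₃ i ℕ.≟ lookup defectCounts₂₃ j) →-dec (i ≟ j)))} _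

mainTheorem2 : (∀ (i : Fin 4) → IsDiffFamily 45 45 44 (proj₁ (family i)) (proj₂ (family i)))
    × (∀ (i j : Fin 4) → i ≢ j → ¬ Equivalent (family i) (family j))
mainTheorem2 = familiesAreDiffFamilies , nonequivalent
  where
  nonequivalent : ∀ i j → i ≢ j → ¬ Equivalent (family i) (family j)
  nonequivalent i j i≢j family-i≈family-j = i≢j (defectCounts₂₃-distinct i j (begin
    lookup defectCounts₂₃ i     ≡⟨ family-pairDefectCount₂₃ i ⟨
    pairDefectCount 23 (family i) ≡⟨ pairDefectCount-equivalent 23 family-i≈family-j ⟩
    pairDefectCount 23 (family j) ≡⟨ family-pairDefectCount₂₃ j ⟩
    lookup defectCounts₂₃ j     ∎))
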